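{- Let $t\le k$ be positive integers and $n,s\ge0$ integers. The number of words $w\in[k]^n$ with $\overleftarrow{\mathrm{des}}_{\{t+1,\ldots,k\}}(w)=s$, which also equals the number of words $w\in[k]^n$ with $\overleftarrow{\mathrm{ris}}_{[k-t]}(w)=s$, is $$\sum_{m=0}^n\sum_{a=0}^m\sum_{b=0}^{a}(-1)^{n-a-s}\binom{m}{a}\binom{a}{b}\binom{(k-t)a}{n-b}\binom{n-m}{s}t^b.$$
   Context: $[k]=\{1,\ldots,k\}$, $[k]^n$ is the set of words of length $n$ over $[k]$. For a word $w=w_1\cdots w_n$ and $X\subseteq\mathbb{N}$, $\overleftarrow{\mathrm{des}}_X(w)=|\{i:w_i>w_{i+1},\ w_i\in X\}|$ and $\overleftarrow{\mathrm{ris}}_X(w)=|\{i:w_i<w_{i+1},\ w_i\in X\}|$. Conventions: $\binom{a}{b}=0$ if $b<0$ or $b>a$ (for $a\ge0$), and $0^0=1$. -}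

module Defs where

open import Data.Nat using (ℕ; zero; suc; _+_; _*_; _∸_; _^_; _<ᵇ_; _≤ᵇ_)
open import Data.Nat.Combinatorics using (_C_)
open import Data.Bool using (Bool; true; false; _∧_; if_then_else_)
open import Data.Fin using (Fin; toℕ)
open import Data.Vec using (Vec; []; _∷_)
open import Data.List using (List; []; _∷_; map; concatMap; length; filterᵇ; sum; upTo)
open import Data.Fin using () renaming (zero to fzero)
open import Data.List using (allFin; foldr)
open import Data.Integer using (ℤ; +_; -_) renaming (_*_ to _*ℤ_; _+_ to _+ℤ_)
import Data.Integer as ℤ
open import Data.Nat using (_%_; _≡ᵇ_)

-- The letter i : Fin k represents the value toℕ i + 1 ∈ [k].
val : {k : ℕ} → Fin k → ℕ
val i = suc (toℕ i)

allWords : (k n : ℕ) → List (Vec (Fin k) n)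
allWords k zero = [] ∷ []
allWords k (suc n) = concatMap (λ a → map (a ∷_) (allWords k n)) (allFin k)

countAdj : {k n : ℕ} → (ℕ → ℕ → Bool) → Vec (Fin k) n → ℕ
countAdj P [] = 0
countAdj P (x ∷ []) = 0
countAdj P (x ∷ y ∷ w) = (if P (val x) (val y) then 1 else 0) + countAdj P (y ∷ w)

desAbove : {k n : ℕ} → ℕ → Vec (Fin k) n → ℕ
desAbove t = countAdj (λ a b → (b <ᵇ a) ∧ (t <ᵇ a))

risBelow : {k n : ℕ} → ℕ → Vec (Fin k) n → ℕ
risBelow r = countAdj (λ a b → (a <ᵇ b) ∧ (a ≤ᵇ r))

count : {A : Set} → (A → Bool) → List A → ℕ
count p xs = length (filterᵇ p xs)

Σ≤ : ℕ → (ℕ → ℤ) → ℤ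
Σ≤ n f = foldr _+ℤ_ (+ 0) (map f (upTo (suc n)))

-- (-1)^e where e ≡ n + a + s (mod 2); this equals (-1)^{n-a-s} for integer exponent n-a-s.
signPow : ℕ → ℤ
signPow e = if (e % 2 ≡ᵇ 0) then + 1 else - (+ 1)

formula : (k t n s : ℕ) → ℤ
formula k t n s =
  Σ≤ n λ m → Σ≤ m λ a → Σ≤ a λ b →
    signPow (n + a + s) *ℤ
    (+ ((m C a) * (a C b) * (((k ∸ t) * a) C (n ∸ b)) * ((n ∸ m) C s) * (t ^ b)))

-- Let u mark the statistic, w = u − 1, and let T n be the u-polynomial of the statistic on
-- [k]^n.  Read the alphabet so that the statistic counts the adjacent pairs a c with a big
-- (rank ≥ t) and c of smaller rank.  Since u = 1 + w, the words of length n + 1 starting with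
-- a have polynomial Σ_{l ≤ n} N_a(l) w^l T(n − l), where N_a(l) counts the chains
-- a > c₁ > ⋯ > c_l whose members other than c_l are big; summing over a turns N into the
-- coefficients of P(z) = (1 + t z)(1 + z)^(k − t), so
--   T(n + 1) = Σ_{l ≤ n} [z^(l+1)] P · w^l T(n − l).
-- Expanding (P − 1)^m and P^a by the binomial theorem, the formula is
-- F n = Σ_{m ≤ n} [z^n] (P − 1)^m · w^(n − m); it obeys the same recurrence because
-- (P − 1)^(m+1) = (P − 1)(P − 1)^m and P − 1 has no constant term.  Both start at 1.

module Submission where

open import Defs
open import Algebra.Bundles using (CommutativeRing)
open import Algebra.Structures using (IsCommutativeRing)
import Algebra.Construct.Pointwise as Pointwise
open import Data.Bool using (Bool; true; false; _∧_; if_then_else_)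
open import Data.Bool.Properties using (∧-comm)
open import Data.Fin as Fin using (Fin; toℕ)
open import Data.Fin.Permutation as Perm using (Permutation′; _⟨$⟩ʳ_)
open import Data.Fin.Properties using (toℕ<n; toℕ-inject₁; toℕ-fromℕ; opposite-prop)
open import Data.Integer as ℤ using (ℤ; +_; -_; _+_; _*_; 0ℤ; 1ℤ; -1ℤ)
import Data.Integer.Properties as ℤ
open import Data.Integer.Tactic.RingSolver using (solve-∀)
open import Data.List using (List; []; _∷_; _++_; foldr; map; applyUpTo; concatMap; tabulate; length; filterᵇ)
open import Data.List.Properties using (filter-++; length-++)
open import Data.Nat as ℕ using (ℕ; zero; suc; _≤_; _<_; _∸_; _≡ᵇ_; _<ᵇ_; _≤ᵇ_; z≤n; s≤s)
import Data.Nat.Properties as ℕ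
open import Data.Nat.Combinatorics using (_C_; nCk+nC[k+1]≡[n+1]C[k+1]; k>n⇒nCk≡0)
open import Data.Nat.Induction using (<-rec)
open import Data.Nat.Tactic.RingSolver using () renaming (solve-∀ to ℕ-solve-∀)
open import Data.Product using (_×_; _,_)
open import Data.Vec using (Vec; _∷_)
open import Function using (_∘_)
open import Level using (0ℓ)
open import Relation.Binary.PropositionalEquality
open import Relation.Nullary.Decidable using (T?)
open import Relation.Nullary.Reflects using (ofʸ; ofⁿ; det; fromEquivalence)
open ≡-Reasoning

open import Algebra.Properties.CommutativeMonoid.Sum ℤ.+-0-commutativeMonoid
  using (sum; sum-cong-≗; sum-replicate-zero; sum-init-last; ∑-distrib-+; ∑-comm; sum-permute)
open import Algebra.Properties.Semiring.Sum ℤ.+-*-semiring using (*-distribˡ-sum; *-distribʳ-sum)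

Σ< : ℕ → (ℕ → ℤ) → ℤ
Σ< n f = sum {n} (f ∘ toℕ)

Σ<-cong : ∀ n {f g : ℕ → ℤ} → (∀ i → i < n → f i ≡ g i) → Σ< n f ≡ Σ< n g
Σ<-cong n f≗g = sum-cong-≗ (λ i → f≗g (toℕ i) (toℕ<n i))

Σ<-zero : ∀ n {f : ℕ → ℤ} → (∀ i → i < n → f i ≡ 0ℤ) → Σ< n f ≡ 0ℤ
Σ<-zero n f≗0 = trans (Σ<-cong n f≗0) (sum-replicate-zero n)

Σ<-ones : ∀ n → Σ< n (λ _ → 1ℤ) ≡ + n
Σ<-ones zero = refl
Σ<-ones (suc n) = cong (_+_ 1ℤ) (Σ<-ones n)

Σ<-*ˡ : ∀ n c (f : ℕ → ℤ) → c * Σ< n f ≡ Σ< n (λ i → c * f i)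
Σ<-*ˡ n c f = *-distribˡ-sum {n} c (f ∘ toℕ)

Σ<-*ʳ : ∀ n c (f : ℕ → ℤ) → Σ< n f * c ≡ Σ< n (λ i → f i * c)
Σ<-*ʳ n c f = *-distribʳ-sum {n} c (f ∘ toℕ)

Σ<-comm : ∀ m n (f : ℕ → ℕ → ℤ) → Σ< m (λ i → Σ< n (f i)) ≡ Σ< n (λ j → Σ< m (λ i → f i j))
Σ<-comm m n f = ∑-comm {m} {n} (λ i j → f (toℕ i) (toℕ j))

Σ<-snoc : ∀ n (f : ℕ → ℤ) → Σ< (suc n) f ≡ Σ< n f + f n
Σ<-snoc n f = trans (sum-init-last {n} (f ∘ toℕ))
  (cong₂ _+_ (sum-cong-≗ {n} (cong f ∘ toℕ-inject₁)) (cong f (toℕ-fromℕ n)))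

Σ<-extend : ∀ {a n} {f : ℕ → ℤ} → a ≤ n → (∀ i → a ≤ i → i < n → f i ≡ 0ℤ) → Σ< n f ≡ Σ< a f
Σ<-extend {n = n} z≤n f≗0 = Σ<-zero n (λ i → f≗0 i z≤n)
Σ<-extend {f = f} (s≤s a≤n) f≗0 =
  cong (_+_ (f 0)) (Σ<-extend a≤n (λ i a≤i i<n → f≗0 (suc i) (s≤s a≤i) (s≤s i<n)))

χ : Bool → ℤ
χ true = 1ℤ
χ false = 0ℤ

Σ<-below : ∀ {a n} (f : ℕ → ℤ) → a ≤ n → Σ< n (λ i → χ (i <ᵇ a) * f i) ≡ Σ< a f
Σ<-below {a} f a≤n = trans
  (Σ<-extend a≤n (λ i a≤i _ → cong (λ b → χ b * f i) (det (ℕ.<ᵇ-reflects-< i a) (ofⁿ (ℕ.≤⇒≯ a≤i)))))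
  (Σ<-cong a (λ i i<a →
    trans (cong (λ b → χ b * f i) (det (ℕ.<ᵇ-reflects-< i a) (ofʸ i<a))) (ℤ.*-identityˡ (f i))))

Σ-interchange : ∀ {k} n (y : Fin k → ℕ → ℤ) (B : ℕ → ℤ) →
  sum (λ c → Σ< n (λ l → y c l * B l)) ≡ Σ< n (λ l → sum (λ c → y c l) * B l)
Σ-interchange {k} n y B = trans (∑-comm {k} {n} (λ c l → y c (toℕ l) * B (toℕ l)))
  (Σ<-cong n (λ l _ → sym (*-distribʳ-sum {k} (B l) (λ c → y c l))))

Σ≤≡Σ< : ∀ n f → Σ≤ n f ≡ Σ< (suc n) f
Σ≤≡Σ< n f = foldr-applyUpTo (suc n) (λ i → i)
  where
  foldr-applyUpTo : ∀ n g → foldr _+_ 0ℤ (map f (applyUpTo g n)) ≡ Σ< n (f ∘ g)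
  foldr-applyUpTo zero g = refl
  foldr-applyUpTo (suc n) g = cong (_+_ (f (g 0))) (foldr-applyUpTo n (g ∘ suc))

pos-^ : ∀ m n → + (m ℕ.^ n) ≡ (+ m) ℤ.^ n
pos-^ m zero = refl
pos-^ m (suc n) = trans (ℤ.pos-* m (m ℕ.^ n)) (cong (+ m *_) (pos-^ m n))

pascal : ∀ n k → + (n C k) + + (n C suc k) ≡ + (suc n C suc k)
pascal n k = trans (sym (ℤ.pos-+ (n C k) (n C suc k))) (cong +_ (nCk+nC[k+1]≡[n+1]C[k+1] n k))

sgn : ℕ → ℤ
sgn e = -1ℤ ℤ.^ e

sgn-+2 : ∀ e → sgn (suc (suc e)) ≡ sgn e
sgn-+2 e = trans (ℤ.-1*i≡-i _) (trans (cong -_ (ℤ.-1*i≡-i (sgn e))) (ℤ.neg-involutive (sgn e)))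

sgn-+ : ∀ m n → sgn (m ℕ.+ n) ≡ sgn m * sgn n
sgn-+ = ℤ.^-distribˡ-+-* -1ℤ

sgn-double : ∀ a → sgn (a ℕ.+ a) ≡ 1ℤ
sgn-double zero = refl
sgn-double (suc a) = trans (cong (sgn ∘ suc) (ℕ.+-suc a a)) (trans (sgn-+2 (a ℕ.+ a)) (sgn-double a))

signPow≡sgn : ∀ e → signPow e ≡ sgn e
signPow≡sgn zero = refl
signPow≡sgn (suc zero) = refl
signPow≡sgn (suc (suc e)) = trans (signPow≡sgn e) (sym (sgn-+2 e))

sgn-regroup : ∀ {a m n} s → a ≤ m → m ≤ n → sgn (n ℕ.+ a ℕ.+ s) ≡ sgn (m ∸ a) * sgn (n ∸ m ℕ.+ s)
sgn-regroup {a} {m} {n} s a≤m m≤n = begin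
  sgn (n ℕ.+ a ℕ.+ s)                   ≡⟨ cong (λ x → sgn (x ℕ.+ a ℕ.+ s)) n≡a+p+q ⟩
  sgn (a ℕ.+ p ℕ.+ q ℕ.+ a ℕ.+ s)       ≡⟨ cong sgn (rearrange a p q s) ⟩
  sgn (p ℕ.+ (q ℕ.+ s) ℕ.+ (a ℕ.+ a))   ≡⟨ sgn-+ (p ℕ.+ (q ℕ.+ s)) (a ℕ.+ a) ⟩
  sgn (p ℕ.+ (q ℕ.+ s)) * sgn (a ℕ.+ a) ≡⟨ cong₂ _*_ (sgn-+ p (q ℕ.+ s)) (sgn-double a) ⟩
  sgn p * sgn (q ℕ.+ s) * 1ℤ            ≡⟨ ℤ.*-identityʳ _ ⟩
  sgn p * sgn (q ℕ.+ s)                 ∎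
  where
  p = m ∸ a
  q = n ∸ m
  n≡a+p+q : n ≡ a ℕ.+ p ℕ.+ q
  n≡a+p+q = sym (trans (cong (ℕ._+ q) (ℕ.m+[n∸m]≡n a≤m)) (ℕ.m+[n∸m]≡n m≤n))
  rearrange : ∀ a p q s → a ℕ.+ p ℕ.+ q ℕ.+ a ℕ.+ s ≡ p ℕ.+ (q ℕ.+ s) ℕ.+ (a ℕ.+ a)
  rearrange = ℕ-solve-∀

-- Used both as series in z (word length) on the formula side and as polynomials in u (the
-- statistic) for the distributions of words.
Series : Set
Series = ℕ → ℤ

infixl 6 _⊕_
infixl 7 _⊛_
infixr 8 _·_
infix 8 ⊝_

_⊕_ : Series → Series → Series
(f ⊕ g) n = f n + g n

⊝_ : Series → Series
(⊝ f) n = - f n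

_·_ : ℤ → Series → Series
(c · f) n = c * f n

0ˢ : Series
0ˢ _ = 0ℤ

1ˢ : Series
1ˢ zero = 1ℤ
1ˢ (suc _) = 0ℤ

_⊛_ : Series → Series → Series
(f ⊛ g) zero = f 0 * g 0
(f ⊛ g) (suc n) = f 0 * g (suc n) + (f ∘ suc ⊛ g) n

coeff-⊛ : ∀ (f g : Series) n → (f ⊛ g) n ≡ Σ< (suc n) (λ i → f i * g (n ∸ i))
coeff-⊛ f g zero = sym (ℤ.+-identityʳ (f 0 * g 0))
coeff-⊛ f g (suc n) = cong (_+_ (f 0 * g (suc n))) (coeff-⊛ (f ∘ suc) g n)

⊛-cong : ∀ {f f′ g g′ : Series} → f ≗ f′ → g ≗ g′ → f ⊛ g ≗ f′ ⊛ g′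
⊛-cong f≗f′ g≗g′ zero = cong₂ _*_ (f≗f′ 0) (g≗g′ 0)
⊛-cong f≗f′ g≗g′ (suc n) =
  cong₂ _+_ (cong₂ _*_ (f≗f′ 0) (g≗g′ (suc n))) (⊛-cong (f≗f′ ∘ suc) g≗g′ n)

⊛-zeroˡ : ∀ g → 0ˢ ⊛ g ≗ 0ˢ
⊛-zeroˡ g zero = refl
⊛-zeroˡ g (suc n) = trans (ℤ.+-identityˡ ((0ˢ ⊛ g) n)) (⊛-zeroˡ g n)

⊛-identityˡ : ∀ g → 1ˢ ⊛ g ≗ g
⊛-identityˡ g zero = ℤ.*-identityˡ (g 0)
⊛-identityˡ g (suc n) =
  trans (cong₂ _+_ (ℤ.*-identityˡ (g (suc n))) (⊛-zeroˡ g n)) (ℤ.+-identityʳ (g (suc n)))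

·-⊛ : ∀ c f g → (c · f) ⊛ g ≗ c · (f ⊛ g)
·-⊛ c f g zero = ℤ.*-assoc c (f 0) (g 0)
·-⊛ c f g (suc n) = trans (cong₂ _+_ (ℤ.*-assoc c (f 0) (g (suc n))) (·-⊛ c (f ∘ suc) g n))
  (sym (ℤ.*-distribˡ-+ c (f 0 * g (suc n)) ((f ∘ suc ⊛ g) n)))

⊛-distribʳ : ∀ h f g → (f ⊕ g) ⊛ h ≗ f ⊛ h ⊕ g ⊛ h
⊛-distribʳ h f g zero = ℤ.*-distribʳ-+ (h 0) (f 0) (g 0)
⊛-distribʳ h f g (suc n) = trans
  (cong₂ _+_ (ℤ.*-distribʳ-+ (h (suc n)) (f 0) (g 0)) (⊛-distribʳ h (f ∘ suc) (g ∘ suc) n))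
  (interchange (f 0 * h (suc n)) (g 0 * h (suc n)) ((f ∘ suc ⊛ h) n) ((g ∘ suc ⊛ h) n))
  where
  interchange : ∀ a b c d → a + b + (c + d) ≡ a + c + (b + d)
  interchange = solve-∀

⊛-snoc : ∀ f g n → (f ⊛ g) (suc n) ≡ (f ⊛ g ∘ suc) n + f (suc n) * g 0
⊛-snoc f g zero = refl
⊛-snoc f g (suc n) = trans (cong (_+_ (f 0 * g (suc (suc n)))) (⊛-snoc (f ∘ suc) g n))
  (sym (ℤ.+-assoc (f 0 * g (suc (suc n))) ((f ∘ suc ⊛ g ∘ suc) n) (f (suc (suc n)) * g 0)))

⊛-comm : ∀ f g → f ⊛ g ≗ g ⊛ f
⊛-comm f g zero = ℤ.*-comm (f 0) (g 0)
⊛-comm f g (suc n) = begin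
  f 0 * g (suc n) + (f ∘ suc ⊛ g) n ≡⟨ cong₂ _+_ (ℤ.*-comm (f 0) (g (suc n))) (⊛-comm (f ∘ suc) g n) ⟩
  g (suc n) * f 0 + (g ⊛ f ∘ suc) n ≡⟨ ℤ.+-comm (g (suc n) * f 0) ((g ⊛ f ∘ suc) n) ⟩
  (g ⊛ f ∘ suc) n + g (suc n) * f 0 ≡⟨ ⊛-snoc g f n ⟨
  (g ⊛ f) (suc n)                   ∎

⊛-distribˡ : ∀ h f g → h ⊛ (f ⊕ g) ≗ h ⊛ f ⊕ h ⊛ g
⊛-distribˡ h f g n = trans (⊛-comm h (f ⊕ g) n)
  (trans (⊛-distribʳ h f g n) (cong₂ _+_ (⊛-comm f h n) (⊛-comm g h n)))

⊛-assoc : ∀ f g h → (f ⊛ g) ⊛ h ≗ f ⊛ (g ⊛ h)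
⊛-assoc f g h zero = ℤ.*-assoc (f 0) (g 0) (h 0)
⊛-assoc f g h (suc n) = begin
  f 0 * g 0 * h (suc n) + ((f 0 · g ∘ suc ⊕ f ∘ suc ⊛ g) ⊛ h) n
    ≡⟨ cong (_+_ (f 0 * g 0 * h (suc n))) (trans (⊛-distribʳ h (f 0 · g ∘ suc) (f ∘ suc ⊛ g) n)
         (cong₂ _+_ (·-⊛ (f 0) (g ∘ suc) h n) (⊛-assoc (f ∘ suc) g h n))) ⟩
  f 0 * g 0 * h (suc n) + (f 0 * (g ∘ suc ⊛ h) n + (f ∘ suc ⊛ (g ⊛ h)) n)
    ≡⟨ regroup (f 0) (g 0) (h (suc n)) ((g ∘ suc ⊛ h) n) ((f ∘ suc ⊛ (g ⊛ h)) n) ⟩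
  f 0 * (g 0 * h (suc n) + (g ∘ suc ⊛ h) n) + (f ∘ suc ⊛ (g ⊛ h)) n ∎
  where
  regroup : ∀ a b c d e → a * b * c + (a * d + e) ≡ a * (b * c + d) + e
  regroup = solve-∀

⊛-identityʳ : ∀ f → f ⊛ 1ˢ ≗ f
⊛-identityʳ f n = trans (⊛-comm f 1ˢ n) (⊛-identityˡ f n)

⊛-zeroʳ : ∀ f → f ⊛ 0ˢ ≗ 0ˢ
⊛-zeroʳ f n = trans (⊛-comm f 0ˢ n) (⊛-zeroˡ f n)

⊛-· : ∀ c f g → f ⊛ (c · g) ≗ c · (f ⊛ g)
⊛-· c f g n = trans (⊛-comm f (c · g) n) (trans (·-⊛ c g f n) (cong (c *_) (⊛-comm g f n)))

⊛-isCommutativeRing : IsCommutativeRing _≗_ _⊕_ _⊛_ ⊝_ 0ˢ 1ˢ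
⊛-isCommutativeRing = record
  { isRing = record
    { +-isAbelianGroup = Pointwise.isAbelianGroup ℕ ℤ.+-0-isAbelianGroup
    ; *-cong = ⊛-cong
    ; *-assoc = ⊛-assoc
    ; *-identity = ⊛-identityˡ , ⊛-identityʳ
    ; distrib = ⊛-distribˡ , ⊛-distribʳ
    }
  ; *-comm = ⊛-comm
  }

⊛-commutativeRing : CommutativeRing 0ℓ 0ℓ
⊛-commutativeRing = record
  { Carrier = Series ; _≈_ = _≗_ ; _+_ = _⊕_ ; _*_ = _⊛_ ; -_ = ⊝_ ; 0# = 0ˢ ; 1# = 1ˢ
  ; isCommutativeRing = ⊛-isCommutativeRing
  }

open CommutativeRing ⊛-commutativeRing using (semiring; commutativeSemiring; *-commutativeSemigroup)
open import Algebra.Properties.CommutativeSemigroup *-commutativeSemigroup using (x∙yz≈y∙xz)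
open import Algebra.Properties.Semiring.Exp semiring using (_^_; ^-homo-*; ^-assocʳ)
open import Algebra.Properties.CommutativeSemiring.Exp commutativeSemiring using (^-distrib-*)
open import Algebra.Properties.Semiring.Mult semiring using () renaming (_×_ to _×ˢ_)
import Algebra.Properties.Semiring.Sum semiring as SeriesSum
import Algebra.Properties.CommutativeSemiring.Binomial commutativeSemiring as Binomial

coeff-sum : ∀ n (G : Fin n → Series) s → SeriesSum.sum G s ≡ sum (λ i → G i s)
coeff-sum zero G s = refl
coeff-sum (suc n) G s = cong (_+_ (G Fin.zero s)) (coeff-sum n (G ∘ Fin.suc) s)

coeff-× : ∀ k f s → (k ×ˢ f) s ≡ + k * f s
coeff-× zero f s = refl
coeff-× (suc k) f s = trans (cong (_+_ (f s)) (coeff-× k f s)) (sym (ℤ.suc-* (+ k) (f s)))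

∑ˢ : ∀ {n} → (Fin n → Series) → Series
∑ˢ G s = sum (λ i → G i s)

Σˢ : ℕ → (ℕ → Series) → Series
Σˢ n G = ∑ˢ {n} (G ∘ toℕ)

⊛-∑ˢ : ∀ f {n} (G : Fin n → Series) → f ⊛ ∑ˢ G ≗ ∑ˢ (λ i → f ⊛ G i)
⊛-∑ˢ f {zero} G = ⊛-zeroʳ f
⊛-∑ˢ f {suc n} G s = trans (⊛-distribˡ f (G Fin.zero) (∑ˢ (G ∘ Fin.suc)) s)
  (cong (_+_ ((f ⊛ G Fin.zero) s)) (⊛-∑ˢ f (G ∘ Fin.suc) s))

⊛-Σˢ : ∀ f n G → f ⊛ Σˢ n G ≗ Σˢ n (λ i → f ⊛ G i)
⊛-Σˢ f n G = ⊛-∑ˢ f {n} (G ∘ toℕ)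

⊛-tail : ∀ {f} g n → f 0 ≡ 0ℤ → (f ⊛ g) (suc n) ≡ (f ∘ suc ⊛ g) n
⊛-tail {f} g n f0≡0 = trans (cong (λ x → x * g (suc n) + (f ∘ suc ⊛ g) n) f0≡0) (ℤ.+-identityˡ _)

⊛-vanish : ∀ f {g} n → (∀ i → i ≤ n → g i ≡ 0ℤ) → (f ⊛ g) n ≡ 0ℤ
⊛-vanish f {g} n g≗0 = trans (coeff-⊛ f g n) (Σ<-zero (suc n) (λ i _ →
  trans (cong (f i *_) (g≗0 (n ∸ i) (ℕ.m∸n≤m n i))) (ℤ.*-zeroʳ (f i))))

⊝1ˢ^≗sgn : ∀ j → (⊝ 1ˢ) ^ j ≗ sgn j · 1ˢ
⊝1ˢ^≗sgn zero s = sym (ℤ.*-identityˡ (1ˢ s))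
⊝1ˢ^≗sgn (suc j) s = begin
  (⊝ 1ˢ ⊛ (⊝ 1ˢ) ^ j) s     ≡⟨ ⊛-cong (λ i → sym (ℤ.-1*i≡-i (1ˢ i))) (⊝1ˢ^≗sgn j) s ⟩
  (-1ℤ · 1ˢ ⊛ sgn j · 1ˢ) s ≡⟨ ·-⊛ -1ℤ 1ˢ (sgn j · 1ˢ) s ⟩
  -1ℤ * (1ˢ ⊛ sgn j · 1ˢ) s ≡⟨ cong (-1ℤ *_) (⊛-identityˡ (sgn j · 1ˢ) s) ⟩
  -1ℤ * (sgn j * 1ˢ s)      ≡⟨ ℤ.*-assoc -1ℤ (sgn j) (1ˢ s) ⟨
  sgn (suc j) * 1ˢ s        ∎

infixl 6 _+X·_

_+X·_ : ℤ → ℤ → Series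
(a +X· b) zero = a
(a +X· b) (suc zero) = b
(a +X· b) (suc (suc _)) = 0ℤ

coeff-+X·⊛ : ∀ a b g s → ((a +X· b) ⊛ g) (suc s) ≡ a * g (suc s) + b * g s
coeff-+X·⊛ a b g s = cong (_+_ (a * g (suc s)))
  (trans (⊛-cong tail≗ (λ _ → refl) s) (trans (·-⊛ b 1ˢ g s) (cong (b *_) (⊛-identityˡ g s))))
  where
  tail≗ : (a +X· b) ∘ suc ≗ b · 1ˢ
  tail≗ zero = sym (ℤ.*-identityʳ b)
  tail≗ (suc n) = sym (ℤ.*-zeroʳ b)

coeff-[1+cX]^ : ∀ c j s → ((1ℤ +X· c) ^ j) s ≡ + (j C s) * c ℤ.^ s
coeff-[1+cX]^ c zero zero = refl
coeff-[1+cX]^ c zero (suc s) = refl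
coeff-[1+cX]^ c (suc j) zero = trans (ℤ.*-identityˡ _) (coeff-[1+cX]^ c j zero)
coeff-[1+cX]^ c (suc j) (suc s) = begin
  ((1ℤ +X· c) ^ suc j) (suc s)
    ≡⟨ coeff-+X·⊛ 1ℤ c ((1ℤ +X· c) ^ j) s ⟩
  1ℤ * ((1ℤ +X· c) ^ j) (suc s) + c * ((1ℤ +X· c) ^ j) s
    ≡⟨ cong₂ (λ x y → 1ℤ * x + c * y) (coeff-[1+cX]^ c j (suc s)) (coeff-[1+cX]^ c j s) ⟩
  1ℤ * (+ (j C suc s) * (c * c ℤ.^ s)) + c * (+ (j C s) * c ℤ.^ s)
    ≡⟨ collect (+ (j C s)) (+ (j C suc s)) c (c ℤ.^ s) ⟩
  (+ (j C s) + + (j C suc s)) * (c * c ℤ.^ s)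
    ≡⟨ cong (_* (c * c ℤ.^ s)) (pascal j s) ⟩
  + (suc j C suc s) * c ℤ.^ suc s ∎
  where
  collect : ∀ x y c p → 1ℤ * (y * (c * p)) + c * (x * p) ≡ (x + y) * (c * p)
  collect = solve-∀

w : Series
w = -1ℤ +X· 1ℤ

coeff-w^ : ∀ j s → (w ^ j) s ≡ sgn (j ℕ.+ s) * + (j C s)
coeff-w^ zero zero = refl
coeff-w^ zero (suc s) = sym (ℤ.*-zeroʳ (sgn (suc s)))
coeff-w^ (suc j) zero = trans (cong (-1ℤ *_) (coeff-w^ j 0)) (sym (ℤ.*-assoc -1ℤ (sgn (j ℕ.+ 0)) 1ℤ))
coeff-w^ (suc j) (suc s) = begin
  (w ^ suc j) (suc s)
    ≡⟨ coeff-+X·⊛ -1ℤ 1ℤ (w ^ j) s ⟩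
  -1ℤ * (w ^ j) (suc s) + 1ℤ * (w ^ j) s
    ≡⟨ cong₂ (λ x y → -1ℤ * x + 1ℤ * y) (coeff-w^ j (suc s)) (coeff-w^ j s) ⟩
  -1ℤ * (sgn (j ℕ.+ suc s) * + (j C suc s)) + 1ℤ * (sgn (j ℕ.+ s) * + (j C s))
    ≡⟨ cong (λ e → -1ℤ * (sgn e * + (j C suc s)) + 1ℤ * (sgn (j ℕ.+ s) * + (j C s))) (ℕ.+-suc j s) ⟩
  -1ℤ * (-1ℤ * sgn (j ℕ.+ s) * + (j C suc s)) + 1ℤ * (sgn (j ℕ.+ s) * + (j C s))
    ≡⟨ collect (sgn (j ℕ.+ s)) (+ (j C s)) (+ (j C suc s)) ⟩
  sgn (j ℕ.+ s) * (+ (j C s) + + (j C suc s))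
    ≡⟨ cong₂ _*_ (sym (sgn-+2 (j ℕ.+ s))) (pascal j s) ⟩
  sgn (suc (suc (j ℕ.+ s))) * + (suc j C suc s)
    ≡⟨ cong (λ e → sgn (suc e) * + (suc j C suc s)) (ℕ.+-suc j s) ⟨
  sgn (suc j ℕ.+ suc s) * + (suc j C suc s) ∎
  where
  collect : ∀ e x y → -1ℤ * (-1ℤ * e * y) + 1ℤ * (e * x) ≡ e * (x + y)
  collect = solve-∀

coeff-⊕w⊛-zero : ∀ g → (g ⊕ w ⊛ g) 0 ≡ 0ℤ
coeff-⊕w⊛-zero g = cancel (g 0)
  where
  cancel : ∀ x → x + -1ℤ * x ≡ 0ℤ
  cancel = solve-∀

coeff-⊕w⊛-suc : ∀ g s → (g ⊕ w ⊛ g) (suc s) ≡ g s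
coeff-⊕w⊛-suc g s = trans (cong (_+_ (g (suc s))) (coeff-+X·⊛ -1ℤ 1ℤ g s)) (cancel (g (suc s)) (g s))
  where
  cancel : ∀ x y → x + (-1ℤ * x + 1ℤ * y) ≡ y
  cancel = solve-∀

Recurrence : (ℕ → Series) → (ℕ → Series) → Set
Recurrence K X = ∀ n → X (suc n) ≗ Σˢ (suc n) (λ l → K l ⊛ X (n ∸ l))

recurrence-unique : ∀ K {X Y} → X 0 ≗ Y 0 → Recurrence K X → Recurrence K Y → ∀ n → X n ≗ Y n
recurrence-unique K {X} {Y} X0≗Y0 recX recY = <-rec (λ n → X n ≗ Y n) step
  where
  step : ∀ n → (∀ {m} → m < n → X m ≗ Y m) → X n ≗ Y n
  step zero _ = X0≗Y0
  step (suc n) ih s = begin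
    X (suc n) s
      ≡⟨ recX n s ⟩
    Σˢ (suc n) (λ l → K l ⊛ X (n ∸ l)) s
      ≡⟨ Σ<-cong (suc n) (λ l _ → ⊛-cong {K l} (λ _ → refl) (ih (s≤s (ℕ.m∸n≤m n l))) s) ⟩
    Σˢ (suc n) (λ l → K l ⊛ Y (n ∸ l)) s
      ≡⟨ recY n s ⟨
    Y (suc n) s ∎

-- For L ≥ 1 the z^L-coefficient counts the strictly decreasing sequences of length L over t
-- small and j big letters in which every letter but the last is big.
blockSeries : ℕ → ℕ → Series
blockSeries t j = (1ℤ +X· + t) ⊛ (1ℤ +X· 1ℤ) ^ j

blockSeries-zero : ∀ t j → blockSeries t j 0 ≡ 1ℤ
blockSeries-zero t j = cong (1ℤ *_) (coeff-[1+cX]^ 1ℤ j 0)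

blockSeries-suc : ∀ t j → blockSeries t (suc j) ≗ (1ℤ +X· 1ℤ) ⊛ blockSeries t j
blockSeries-suc t j = x∙yz≈y∙xz (1ℤ +X· + t) (1ℤ +X· 1ℤ) ((1ℤ +X· 1ℤ) ^ j)

blockKernel : ℕ → ℕ → ℕ → Series
blockKernel t j l = blockSeries t j (suc l) · w ^ l

module FormulaSide (k t : ℕ) where

  r : ℕ
  r = k ∸ t

  P : Series
  P = blockSeries t r

  D : Series
  D = P ⊕ ⊝ 1ˢ

  D-zero : D 0 ≡ 0ℤ
  D-zero = cong (_+ -1ℤ) (blockSeries-zero t r)

  D^-vanish : ∀ m j → j < m → (D ^ m) j ≡ 0ℤ
  D^-vanish (suc m) zero _ = cong (_* (D ^ m) 0) D-zero
  D^-vanish (suc m) (suc j) (s≤s j<m) = trans (⊛-tail {D} (D ^ m) j D-zero)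
    (⊛-vanish (D ∘ suc) j (λ i i≤j → D^-vanish m i (ℕ.≤-<-trans i≤j j<m)))

  coeff-D^suc : ∀ m n → (D ^ suc m) (suc n) ≡ Σ< (suc n) (λ l → P (suc l) * (D ^ m) (n ∸ l))
  coeff-D^suc m n = trans (⊛-tail {D} (D ^ m) n D-zero) (trans (coeff-⊛ (D ∘ suc) (D ^ m) n)
    (Σ<-cong (suc n) (λ l _ → cong (_* (D ^ m) (n ∸ l)) (ℤ.+-identityʳ (P (suc l))))))

  F : ℕ → Series
  F n = Σˢ (suc n) (λ m → (D ^ m) n · w ^ (n ∸ m))

  F-zero : F 0 ≗ 1ˢ
  F-zero s = trans (ℤ.+-identityʳ _) (ℤ.*-identityˡ (1ˢ s))

  F-shift : ∀ l n s → l ≤ n → Σ< (suc n) (λ m → (D ^ m) (n ∸ l) * (w ^ (n ∸ m)) s) ≡ (w ^ l ⊛ F (n ∸ l)) s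
  F-shift l n s l≤n = begin
    Σ< (suc n) (λ m → (D ^ m) j * (w ^ (n ∸ m)) s)
      ≡⟨ Σ<-extend (s≤s (ℕ.m∸n≤m n l)) vanish ⟩
    Σ< (suc j) (λ m → (D ^ m) j * (w ^ (n ∸ m)) s)
      ≡⟨ Σ<-cong (suc j) (λ m m<1+j → cong ((D ^ m) j *_) (split-exponent m (ℕ.≤-pred m<1+j))) ⟩
    Σ< (suc j) (λ m → (D ^ m) j * (w ^ l ⊛ w ^ (j ∸ m)) s)
      ≡⟨ Σ<-cong (suc j) (λ m _ → ⊛-· ((D ^ m) j) (w ^ l) (w ^ (j ∸ m)) s) ⟨
    Σˢ (suc j) (λ m → w ^ l ⊛ (D ^ m) j · w ^ (j ∸ m)) s
      ≡⟨ ⊛-Σˢ (w ^ l) (suc j) (λ m → (D ^ m) j · w ^ (j ∸ m)) s ⟨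
    (w ^ l ⊛ F j) s ∎
    where
    j = n ∸ l
    vanish : ∀ m → suc j ≤ m → m < suc n → (D ^ m) j * (w ^ (n ∸ m)) s ≡ 0ℤ
    vanish m j<m _ = cong (_* (w ^ (n ∸ m)) s) (D^-vanish m j j<m)
    split-exponent : ∀ m → m ≤ j → (w ^ (n ∸ m)) s ≡ (w ^ l ⊛ w ^ (j ∸ m)) s
    split-exponent m m≤j = trans (cong (λ e → (w ^ e) s) n∸m≡l+[j∸m]) (^-homo-* w l (j ∸ m) s)
      where
      n∸m≡l+[j∸m] : n ∸ m ≡ l ℕ.+ (j ∸ m)
      n∸m≡l+[j∸m] = trans (cong (_∸ m) (sym (ℕ.m+[n∸m]≡n l≤n))) (ℕ.+-∸-assoc l m≤j)

  F-rec : Recurrence (blockKernel t r) F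
  F-rec n s = begin
    F (suc n) s
      ≡⟨ ℤ.+-identityˡ _ ⟩
    Σ< (suc n) (λ m → (D ^ suc m) (suc n) * (w ^ (n ∸ m)) s)
      ≡⟨ Σ<-cong (suc n) (λ m _ → trans (cong (_* (w ^ (n ∸ m)) s) (coeff-D^suc m n))
           (trans (Σ<-*ʳ (suc n) ((w ^ (n ∸ m)) s) (λ l → P (suc l) * (D ^ m) (n ∸ l)))
             (Σ<-cong (suc n) (λ l _ → ℤ.*-assoc (P (suc l)) ((D ^ m) (n ∸ l)) ((w ^ (n ∸ m)) s))))) ⟩
    Σ< (suc n) (λ m → Σ< (suc n) (λ l → P (suc l) * ((D ^ m) (n ∸ l) * (w ^ (n ∸ m)) s)))
      ≡⟨ Σ<-comm (suc n) (suc n) (λ m l → P (suc l) * ((D ^ m) (n ∸ l) * (w ^ (n ∸ m)) s)) ⟩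
    Σ< (suc n) (λ l → Σ< (suc n) (λ m → P (suc l) * ((D ^ m) (n ∸ l) * (w ^ (n ∸ m)) s)))
      ≡⟨ Σ<-cong (suc n) (λ l l<1+n →
           trans (sym (Σ<-*ˡ (suc n) (P (suc l)) (λ m → (D ^ m) (n ∸ l) * (w ^ (n ∸ m)) s)))
             (cong (P (suc l) *_) (F-shift l n s (ℕ.≤-pred l<1+n)))) ⟩
    Σ< (suc n) (λ l → P (suc l) * (w ^ l ⊛ F (n ∸ l)) s)
      ≡⟨ Σ<-cong (suc n) (λ l _ → ·-⊛ (P (suc l)) (w ^ l) (F (n ∸ l)) s) ⟨
    Σˢ (suc n) (λ l → blockKernel t r l ⊛ F (n ∸ l)) s ∎

  coeff-D^ : ∀ m n → (D ^ m) n ≡ Σ< (suc m) (λ a → + (m C a) * (sgn (m ∸ a) * (P ^ a) n))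
  coeff-D^ m n = begin
    (D ^ m) n                                             ≡⟨ Binomial.theorem m P (⊝ 1ˢ) n ⟩
    SeriesSum.sum (Binomial.binomialTerm P (⊝ 1ˢ) m) n    ≡⟨ coeff-sum (suc m) (Binomial.binomialTerm P (⊝ 1ˢ) m) n ⟩
    sum (λ a → Binomial.binomialTerm P (⊝ 1ˢ) m a n)       ≡⟨ sum-cong-≗ {suc m} (λ a → term (toℕ a)) ⟩
    Σ< (suc m) (λ a → + (m C a) * (sgn (m ∸ a) * (P ^ a) n)) ∎
    where
    term : ∀ a → ((m C a) ×ˢ (P ^ a ⊛ (⊝ 1ˢ) ^ (m ∸ a))) n ≡ + (m C a) * (sgn (m ∸ a) * (P ^ a) n)
    term a = trans (coeff-× (m C a) (P ^ a ⊛ (⊝ 1ˢ) ^ (m ∸ a)) n) (cong (+ (m C a) *_)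
      (trans (⊛-cong {P ^ a} (λ _ → refl) (⊝1ˢ^≗sgn (m ∸ a)) n) (trans (⊛-· (sgn (m ∸ a)) (P ^ a) 1ˢ n)
        (cong (sgn (m ∸ a) *_) (⊛-identityʳ (P ^ a) n)))))

  coeff-P^ : ∀ a n → a ≤ n → (P ^ a) n ≡ Σ< (suc a) (λ b → + (a C b) * (+ t) ℤ.^ b * + ((r ℕ.* a) C (n ∸ b)))
  coeff-P^ a n a≤n = begin
    (((1ℤ +X· + t) ⊛ (1ℤ +X· 1ℤ) ^ r) ^ a) n
      ≡⟨ ^-distrib-* (1ℤ +X· + t) ((1ℤ +X· 1ℤ) ^ r) a n ⟩
    ((1ℤ +X· + t) ^ a ⊛ ((1ℤ +X· 1ℤ) ^ r) ^ a) n
      ≡⟨ ⊛-cong {(1ℤ +X· + t) ^ a} (λ _ → refl) (^-assocʳ (1ℤ +X· 1ℤ) r a) n ⟩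
    ((1ℤ +X· + t) ^ a ⊛ (1ℤ +X· 1ℤ) ^ (r ℕ.* a)) n
      ≡⟨ coeff-⊛ ((1ℤ +X· + t) ^ a) ((1ℤ +X· 1ℤ) ^ (r ℕ.* a)) n ⟩
    Σ< (suc n) (λ b → ((1ℤ +X· + t) ^ a) b * ((1ℤ +X· 1ℤ) ^ (r ℕ.* a)) (n ∸ b))
      ≡⟨ Σ<-cong (suc n) (λ b _ → cong₂ _*_ (coeff-[1+cX]^ (+ t) a b) (coeff-[1+X]^ (r ℕ.* a) (n ∸ b))) ⟩
    Σ< (suc n) (λ b → + (a C b) * (+ t) ℤ.^ b * + ((r ℕ.* a) C (n ∸ b)))
      ≡⟨ Σ<-extend (s≤s a≤n) vanish ⟩
    Σ< (suc a) (λ b → + (a C b) * (+ t) ℤ.^ b * + ((r ℕ.* a) C (n ∸ b))) ∎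
    where
    coeff-[1+X]^ : ∀ j s → ((1ℤ +X· 1ℤ) ^ j) s ≡ + (j C s)
    coeff-[1+X]^ j s = trans (coeff-[1+cX]^ 1ℤ j s) (trans (cong (+ (j C s) *_) (ℤ.^-zeroˡ s)) (ℤ.*-identityʳ _))
    vanish : ∀ b → suc a ≤ b → b < suc n → + (a C b) * (+ t) ℤ.^ b * + ((r ℕ.* a) C (n ∸ b)) ≡ 0ℤ
    vanish b a<b _ = cong (λ x → + x * (+ t) ℤ.^ b * + ((r ℕ.* a) C (n ∸ b))) (k>n⇒nCk≡0 a<b)

  formulaTerm : ℕ → ℕ → ℕ → ℕ → ℕ → ℤ
  formulaTerm n s m a b =
    signPow (n ℕ.+ a ℕ.+ s) * + ((m C a) ℕ.* (a C b) ℕ.* ((r ℕ.* a) C (n ∸ b)) ℕ.* ((n ∸ m) C s) ℕ.* (t ℕ.^ b))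

  formulaTerm-regroup : ∀ {m a} n s b → a ≤ m → m ≤ n →
    formulaTerm n s m a b
    ≡ + (m C a) * (sgn (m ∸ a) * (+ (a C b) * (+ t) ℤ.^ b * + ((r ℕ.* a) C (n ∸ b)))) * (w ^ (n ∸ m)) s
  formulaTerm-regroup {m} {a} n s b a≤m m≤n = begin
    signPow (n ℕ.+ a ℕ.+ s) * + (x₁ ℕ.* x₂ ℕ.* x₃ ℕ.* x₄ ℕ.* t ℕ.^ b)
      ≡⟨ cong₂ _*_ (trans (signPow≡sgn (n ℕ.+ a ℕ.+ s)) (sgn-regroup s a≤m m≤n)) pos-product ⟩
    sgn (m ∸ a) * sgn (n ∸ m ℕ.+ s) * (+ x₁ * + x₂ * + x₃ * + x₄ * (+ t) ℤ.^ b)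
      ≡⟨ regroup (sgn (m ∸ a)) (sgn (n ∸ m ℕ.+ s)) (+ x₁) (+ x₂) (+ x₃) (+ x₄) ((+ t) ℤ.^ b) ⟩
    + x₁ * (sgn (m ∸ a) * (+ x₂ * (+ t) ℤ.^ b * + x₃)) * (sgn (n ∸ m ℕ.+ s) * + x₄)
      ≡⟨ cong (+ x₁ * (sgn (m ∸ a) * (+ x₂ * (+ t) ℤ.^ b * + x₃)) *_) (coeff-w^ (n ∸ m) s) ⟨
    + x₁ * (sgn (m ∸ a) * (+ x₂ * (+ t) ℤ.^ b * + x₃)) * (w ^ (n ∸ m)) s ∎
    where
    x₁ = m C a
    x₂ = a C b
    x₃ = (r ℕ.* a) C (n ∸ b)
    x₄ = (n ∸ m) C s
    pos-product : + (x₁ ℕ.* x₂ ℕ.* x₃ ℕ.* x₄ ℕ.* t ℕ.^ b) ≡ + x₁ * + x₂ * + x₃ * + x₄ * (+ t) ℤ.^ b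
    pos-product = trans (ℤ.pos-* (x₁ ℕ.* x₂ ℕ.* x₃ ℕ.* x₄) (t ℕ.^ b)) (cong₂ _*_
      (trans (ℤ.pos-* (x₁ ℕ.* x₂ ℕ.* x₃) x₄) (cong (_* + x₄)
        (trans (ℤ.pos-* (x₁ ℕ.* x₂) x₃) (cong (_* + x₃) (ℤ.pos-* x₁ x₂)))))
      (pos-^ t b))
    regroup : ∀ σ τ y₁ y₂ y₃ y₄ y₅ →
      σ * τ * (y₁ * y₂ * y₃ * y₄ * y₅) ≡ y₁ * (σ * (y₂ * y₅ * y₃)) * (τ * y₄)
    regroup = solve-∀

  formula-cell : ∀ {m a} n s → a ≤ m → m ≤ n →
    Σ≤ a (formulaTerm n s m a) ≡ + (m C a) * (sgn (m ∸ a) * (P ^ a) n) * (w ^ (n ∸ m)) s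
  formula-cell {m} {a} n s a≤m m≤n = begin
    Σ≤ a (formulaTerm n s m a)
      ≡⟨ Σ≤≡Σ< a (formulaTerm n s m a) ⟩
    Σ< (suc a) (formulaTerm n s m a)
      ≡⟨ Σ<-cong (suc a) (λ b _ → formulaTerm-regroup n s b a≤m m≤n) ⟩
    Σ< (suc a) (λ b → + (m C a) * (sgn (m ∸ a) * p b) * W)
      ≡⟨ Σ<-*ʳ (suc a) W (λ b → + (m C a) * (sgn (m ∸ a) * p b)) ⟨
    Σ< (suc a) (λ b → + (m C a) * (sgn (m ∸ a) * p b)) * W
      ≡⟨ cong (_* W) (Σ<-*ˡ (suc a) (+ (m C a)) (λ b → sgn (m ∸ a) * p b)) ⟨
    + (m C a) * Σ< (suc a) (λ b → sgn (m ∸ a) * p b) * W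
      ≡⟨ cong (λ x → + (m C a) * x * W) (Σ<-*ˡ (suc a) (sgn (m ∸ a)) p) ⟨
    + (m C a) * (sgn (m ∸ a) * Σ< (suc a) p) * W
      ≡⟨ cong (λ x → + (m C a) * (sgn (m ∸ a) * x) * W) (coeff-P^ a n (ℕ.≤-trans a≤m m≤n)) ⟨
    + (m C a) * (sgn (m ∸ a) * (P ^ a) n) * W ∎
    where
    W = (w ^ (n ∸ m)) s
    p : ℕ → ℤ
    p b = + (a C b) * (+ t) ℤ.^ b * + ((r ℕ.* a) C (n ∸ b))

  formula-column : ∀ {m} n s → m ≤ n →
    Σ≤ m (λ a → Σ≤ a (formulaTerm n s m a)) ≡ (D ^ m) n * (w ^ (n ∸ m)) s
  formula-column {m} n s m≤n = begin
    Σ≤ m (λ a → Σ≤ a (formulaTerm n s m a))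
      ≡⟨ Σ≤≡Σ< m (λ a → Σ≤ a (formulaTerm n s m a)) ⟩
    Σ< (suc m) (λ a → Σ≤ a (formulaTerm n s m a))
      ≡⟨ Σ<-cong (suc m) (λ a a<1+m → formula-cell n s (ℕ.≤-pred a<1+m) m≤n) ⟩
    Σ< (suc m) (λ a → + (m C a) * (sgn (m ∸ a) * (P ^ a) n) * W)
      ≡⟨ Σ<-*ʳ (suc m) W (λ a → + (m C a) * (sgn (m ∸ a) * (P ^ a) n)) ⟨
    Σ< (suc m) (λ a → + (m C a) * (sgn (m ∸ a) * (P ^ a) n)) * W
      ≡⟨ cong (_* W) (coeff-D^ m n) ⟨
    (D ^ m) n * W ∎
    where
    W = (w ^ (n ∸ m)) s

  formula≡F : ∀ n s → formula k t n s ≡ F n s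
  formula≡F n s = trans (Σ≤≡Σ< n (λ m → Σ≤ m λ a → Σ≤ a (formulaTerm n s m a)))
    (Σ<-cong (suc n) (λ m m<1+n → formula-column n s (ℕ.≤-pred m<1+n)))

module Chains (t : ℕ) where

  -- chains i l counts the sequences i > c₁ > ⋯ > c_l in which every term but the last is ≥ t.
  chains : ℕ → ℕ → ℤ
  chains i zero = 1ℤ
  chains i (suc l) = if t ≤ᵇ i then Σ< i (λ j → chains j l) else 0ℤ

  chains-big : ∀ {i} l → t ≤ i → chains i (suc l) ≡ Σ< i (λ j → chains j l)
  chains-big {i} l t≤i =
    cong (λ b → if b then Σ< i (λ j → chains j l) else 0ℤ) (det (ℕ.≤ᵇ-reflects-≤ t i) (ofʸ t≤i))

  chains-small : ∀ {i} l → i < t → chains i (suc l) ≡ 0ℤ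
  chains-small {i} l i<t =
    cong (λ b → if b then Σ< i (λ j → chains j l) else 0ℤ) (det (ℕ.≤ᵇ-reflects-≤ t i) (ofⁿ (ℕ.<⇒≱ i<t)))

  chains-blockSeries : ∀ j → chains (j ℕ.+ t) ≗ blockSeries t j
  chains-blockSeries j zero = sym (blockSeries-zero t j)
  chains-blockSeries zero (suc zero) =
    trans (chains-big 0 ℕ.≤-refl) (trans (Σ<-ones t) (sym (⊛-identityʳ (1ℤ +X· + t) 1)))
  chains-blockSeries zero (suc (suc l)) = trans (chains-big (suc l) ℕ.≤-refl)
    (trans (Σ<-zero t (λ i → chains-small l)) (sym (⊛-identityʳ (1ℤ +X· + t) (suc (suc l)))))
  chains-blockSeries (suc j) (suc l) = begin
    chains (suc j ℕ.+ t) (suc l)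
      ≡⟨ chains-big l (ℕ.m≤n+m t (suc j)) ⟩
    Σ< (suc (j ℕ.+ t)) (λ i → chains i l)
      ≡⟨ Σ<-snoc (j ℕ.+ t) (λ i → chains i l) ⟩
    Σ< (j ℕ.+ t) (λ i → chains i l) + chains (j ℕ.+ t) l
      ≡⟨ cong (_+ chains (j ℕ.+ t) l) (chains-big l (ℕ.m≤n+m t j)) ⟨
    chains (j ℕ.+ t) (suc l) + chains (j ℕ.+ t) l
      ≡⟨ cong₂ _+_ (chains-blockSeries j (suc l)) (chains-blockSeries j l) ⟩
    blockSeries t j (suc l) + blockSeries t j l
      ≡⟨ cong₂ _+_ (ℤ.*-identityˡ (blockSeries t j (suc l))) (ℤ.*-identityˡ (blockSeries t j l)) ⟨
    1ℤ * blockSeries t j (suc l) + 1ℤ * blockSeries t j l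
      ≡⟨ coeff-+X·⊛ 1ℤ 1ℤ (blockSeries t j) l ⟨
    ((1ℤ +X· 1ℤ) ⊛ blockSeries t j) (suc l)
      ≡⟨ blockSeries-suc t j (suc l) ⟨
    blockSeries t (suc j) (suc l) ∎

count-++ : ∀ {A : Set} (p : A → Bool) xs ys → count p (xs ++ ys) ≡ count p xs ℕ.+ count p ys
count-++ p xs ys = trans (cong length (filter-++ (T? ∘ p) xs ys)) (length-++ (filterᵇ p xs))

count-map : ∀ {A B : Set} (p : B → Bool) (g : A → B) xs → count p (map g xs) ≡ count (p ∘ g) xs
count-map p g [] = refl
count-map p g (x ∷ xs) with p (g x)
... | true = cong suc (count-map p g xs)
... | false = count-map p g xs

count-none : ∀ {A : Set} (xs : List A) → count (λ _ → false) xs ≡ 0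
count-none [] = refl
count-none (x ∷ xs) = count-none xs

dist : {A : Set} → (A → ℕ) → List A → Series
dist f xs s = + count (λ x → f x ≡ᵇ s) xs

dist-concatMap : ∀ {A B : Set} {k} (f : B → ℕ) (h : A → List B) (g : Fin k → A) →
  dist f (concatMap h (tabulate g)) ≗ ∑ˢ (λ c → dist f (h (g c)))
dist-concatMap {k = zero} f h g s = refl
dist-concatMap {k = suc k} f h g s = begin
  + count p (h (g Fin.zero) ++ concatMap h (tabulate (g ∘ Fin.suc)))
    ≡⟨ cong +_ (count-++ p (h (g Fin.zero)) (concatMap h (tabulate (g ∘ Fin.suc)))) ⟩
  + (count p (h (g Fin.zero)) ℕ.+ count p (concatMap h (tabulate (g ∘ Fin.suc))))
    ≡⟨ ℤ.pos-+ (count p (h (g Fin.zero))) (count p (concatMap h (tabulate (g ∘ Fin.suc)))) ⟩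
  dist f (h (g Fin.zero)) s + dist f (concatMap h (tabulate (g ∘ Fin.suc))) s
    ≡⟨ cong (_+_ (dist f (h (g Fin.zero)) s)) (dist-concatMap f h (g ∘ Fin.suc) s) ⟩
  ∑ˢ (λ c → dist f (h (g c))) s ∎
  where
  p = λ x → f x ≡ᵇ s

dist-allWords-suc : ∀ {k} n (f : Vec (Fin k) (suc n) → ℕ) →
  dist f (allWords k (suc n)) ≗ ∑ˢ (λ a → dist (f ∘ (a ∷_)) (allWords k n))
dist-allWords-suc {k} n f s = trans (dist-concatMap f (λ a → map (a ∷_) (allWords k n)) (λ a → a) s)
  (sum-cong-≗ {k} (λ a → cong +_ (count-map (λ x → f x ≡ᵇ s) (a ∷_) (allWords k n))))

dist-step : ∀ {A : Set} b (f : A → ℕ) xs →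
  dist (λ x → (if b then 1 else 0) ℕ.+ f x) xs ≗ dist f xs ⊕ χ b · (w ⊛ dist f xs)
dist-step false f xs s = sym (ℤ.+-identityʳ (dist f xs s))
dist-step true f xs zero = trans (cong +_ (count-none xs))
  (sym (trans (cong (_+_ (dist f xs 0)) (ℤ.*-identityˡ ((w ⊛ dist f xs) 0))) (coeff-⊕w⊛-zero (dist f xs))))
dist-step true f xs (suc s) =
  sym (trans (cong (_+_ (dist f xs (suc s))) (ℤ.*-identityˡ ((w ⊛ dist f xs) (suc s))))
    (coeff-⊕w⊛-suc (dist f xs) s))

-- Letters are ranked through π: π = id gives the descents at letters > t, π = reverse the
-- rises at letters ≤ k − t.
module WordSide (k t : ℕ) (t≤k : t ≤ k) (P : ℕ → ℕ → Bool) (π : Permutation′ k)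
  (P-spec : ∀ a c → P (val a) (val c) ≡ (t ≤ᵇ toℕ (π ⟨$⟩ʳ a)) ∧ (toℕ (π ⟨$⟩ʳ c) <ᵇ toℕ (π ⟨$⟩ʳ a)))
  where

  open Chains t

  rank : Fin k → ℕ
  rank a = toℕ (π ⟨$⟩ʳ a)

  T : ℕ → Series
  T n = dist (countAdj P) (allWords k n)

  A : ℕ → Fin k → Series
  A n a = dist (countAdj P ∘ (a ∷_)) (allWords k n)

  T-zero : T 0 ≗ 1ˢ
  T-zero zero = refl
  T-zero (suc s) = refl

  A-zero : ∀ a → A 0 a ≗ 1ˢ
  A-zero a zero = refl
  A-zero a (suc s) = refl

  A-suc : ∀ n a → A (suc n) a ≗ T (suc n) ⊕ w ⊛ ∑ˢ (λ c → χ (P (val a) (val c)) · A n c)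
  A-suc n a s = begin
    A (suc n) a s
      ≡⟨ dist-allWords-suc n (countAdj P ∘ (a ∷_)) s ⟩
    sum (λ c → dist (λ ws → countAdj P (a ∷ c ∷ ws)) (allWords k n) s)
      ≡⟨ sum-cong-≗ {k} (λ c → dist-step (P (val a) (val c)) (countAdj P ∘ (c ∷_)) (allWords k n) s) ⟩
    sum (λ c → A n c s + χ (P (val a) (val c)) * (w ⊛ A n c) s)
      ≡⟨ ∑-distrib-+ {k} (λ c → A n c s) (λ c → χ (P (val a) (val c)) * (w ⊛ A n c) s) ⟩
    sum (λ c → A n c s) + sum (λ c → χ (P (val a) (val c)) * (w ⊛ A n c) s)
      ≡⟨ cong₂ _+_ (dist-allWords-suc {k} n (countAdj P) s)
           (sum-cong-≗ {k} (λ c → ⊛-· (χ (P (val a) (val c))) w (A n c) s)) ⟨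
    T (suc n) s + ∑ˢ (λ c → w ⊛ χ (P (val a) (val c)) · A n c) s
      ≡⟨ cong (_+_ (T (suc n) s)) (⊛-∑ˢ w (λ c → χ (P (val a) (val c)) · A n c) s) ⟨
    T (suc n) s + (w ⊛ ∑ˢ (λ c → χ (P (val a) (val c)) · A n c)) s ∎

  chains-step : ∀ a l → sum (λ c → χ (P (val a) (val c)) * chains (rank c) l) ≡ chains (rank a) (suc l)
  chains-step a l =
    trans (sum-cong-≗ {k} (λ c → cong (λ b → χ b * chains (rank c) l) (P-spec a c))) (below (t ≤ᵇ rank a))
    where
    below : ∀ b → sum (λ c → χ (b ∧ (rank c <ᵇ rank a)) * chains (rank c) l)
                ≡ (if b then Σ< (rank a) (λ j → chains j l) else 0ℤ)
    below false = sum-replicate-zero k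
    below true = trans (sym (sum-permute (λ i → χ (toℕ i <ᵇ rank a) * chains (toℕ i) l) π))
      (Σ<-below (λ j → chains j l) (ℕ.<⇒≤ (toℕ<n (π ⟨$⟩ʳ a))))

  B : ℕ → ℕ → Series
  B n l = w ^ l ⊛ T (n ∸ l)

  A-expansion : ∀ n a → A n a ≗ Σˢ (suc n) (λ l → chains (rank a) l · B n l)
  A-expansion zero a s = trans (A-zero a s) (sym (trans (ℤ.+-identityʳ (1ℤ * (1ˢ ⊛ T 0) s))
    (trans (ℤ.*-identityˡ ((1ˢ ⊛ T 0) s)) (trans (⊛-identityˡ (T 0) s) (T-zero s)))))
  A-expansion (suc n) a s = begin
    A (suc n) a s
      ≡⟨ A-suc n a s ⟩
    T (suc n) s + (w ⊛ ∑ˢ (λ c → χ (P (val a) (val c)) · A n c)) s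
      ≡⟨ cong (_+_ (T (suc n) s)) (⊛-cong {w} (λ _ → refl) later s) ⟩
    T (suc n) s + (w ⊛ Σˢ (suc n) (λ l → chains (rank a) (suc l) · B n l)) s
      ≡⟨ cong (_+_ (T (suc n) s)) (trans (⊛-Σˢ w (suc n) (λ l → chains (rank a) (suc l) · B n l) s)
           (Σ<-cong (suc n) (λ l _ → trans (⊛-· (chains (rank a) (suc l)) w (B n l) s)
             (cong (chains (rank a) (suc l) *_) (sym (⊛-assoc w (w ^ l) (T (n ∸ l)) s)))))) ⟩
    T (suc n) s + Σ< (suc n) (λ l → chains (rank a) (suc l) * B (suc n) (suc l) s)
      ≡⟨ cong (_+ Σ< (suc n) (λ l → chains (rank a) (suc l) * B (suc n) (suc l) s))
           (trans (ℤ.*-identityˡ _) (⊛-identityˡ (T (suc n)) s)) ⟨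
    Σˢ (suc (suc n)) (λ l → chains (rank a) l · B (suc n) l) s ∎
    where
    later : ∑ˢ (λ c → χ (P (val a) (val c)) · A n c) ≗ Σˢ (suc n) (λ l → chains (rank a) (suc l) · B n l)
    later s = begin
      sum (λ c → χ (P (val a) (val c)) * A n c s)
        ≡⟨ sum-cong-≗ {k} (λ c → trans (cong (χ (P (val a) (val c)) *_) (A-expansion n c s))
             (trans (Σ<-*ˡ (suc n) (χ (P (val a) (val c))) (λ l → chains (rank c) l * B n l s))
               (Σ<-cong (suc n) (λ l _ → sym (ℤ.*-assoc (χ (P (val a) (val c))) (chains (rank c) l) (B n l s)))))) ⟩
      sum (λ c → Σ< (suc n) (λ l → χ (P (val a) (val c)) * chains (rank c) l * B n l s))
        ≡⟨ Σ-interchange (suc n) (λ c l → χ (P (val a) (val c)) * chains (rank c) l) (λ l → B n l s) ⟩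
      Σ< (suc n) (λ l → sum (λ c → χ (P (val a) (val c)) * chains (rank c) l) * B n l s)
        ≡⟨ Σ<-cong (suc n) (λ l _ → cong (_* B n l s) (chains-step a l)) ⟩
      Σ< (suc n) (λ l → chains (rank a) (suc l) * B n l s) ∎

  alphabet-sum : ∀ l → sum (λ a → chains (rank a) l) ≡ blockSeries t (k ∸ t) (suc l)
  alphabet-sum l = begin
    sum (λ a → chains (rank a) l) ≡⟨ sum-permute (λ i → chains (toℕ i) l) π ⟨
    Σ< k (λ i → chains i l)       ≡⟨ chains-big l t≤k ⟨
    chains k (suc l)              ≡⟨ cong (λ i → chains i (suc l)) (ℕ.m∸n+n≡m t≤k) ⟨
    chains (k ∸ t ℕ.+ t) (suc l)  ≡⟨ chains-blockSeries (k ∸ t) (suc l) ⟩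
    blockSeries t (k ∸ t) (suc l) ∎

  T-rec : Recurrence (blockKernel t (k ∸ t)) T
  T-rec n s = begin
    T (suc n) s
      ≡⟨ dist-allWords-suc {k} n (countAdj P) s ⟩
    sum (λ a → A n a s)
      ≡⟨ sum-cong-≗ {k} (λ a → A-expansion n a s) ⟩
    sum (λ a → Σ< (suc n) (λ l → chains (rank a) l * B n l s))
      ≡⟨ Σ-interchange (suc n) (λ a l → chains (rank a) l) (λ l → B n l s) ⟩
    Σ< (suc n) (λ l → sum (λ a → chains (rank a) l) * B n l s)
      ≡⟨ Σ<-cong (suc n) (λ l _ → trans (cong (_* B n l s) (alphabet-sum l))
           (sym (·-⊛ (blockSeries t (k ∸ t) (suc l)) (w ^ l) (T (n ∸ l)) s))) ⟩
    Σˢ (suc n) (λ l → blockKernel t (k ∸ t) l ⊛ T (n ∸ l)) s ∎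

  T≡formula : ∀ n s → T n s ≡ formula k t n s
  T≡formula n s = trans
    (recurrence-unique (blockKernel t (k ∸ t)) (λ s → trans (T-zero s) (sym (F-zero s))) T-rec F-rec n s)
    (sym (formula≡F n s))
    where
    open FormulaSide k t

<ᵇ-suc : ∀ m n → (m <ᵇ suc n) ≡ (m ≤ᵇ n)
<ᵇ-suc zero n = refl
<ᵇ-suc (suc m) n = refl

descent-spec : ∀ {k} t (a c : Fin k) →
  (val c <ᵇ val a) ∧ (t <ᵇ val a)
  ≡ (t ≤ᵇ toℕ (Perm.id ⟨$⟩ʳ a)) ∧ (toℕ (Perm.id ⟨$⟩ʳ c) <ᵇ toℕ (Perm.id ⟨$⟩ʳ a))
descent-spec t a c =
  trans (cong ((toℕ c <ᵇ toℕ a) ∧_) (<ᵇ-suc t (toℕ a))) (∧-comm (toℕ c <ᵇ toℕ a) (t ≤ᵇ toℕ a))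

∸-swap : ∀ {m n o} → n ≤ o → m ≤ o ∸ n → n ≤ o ∸ m
∸-swap {m} {n} {o} n≤o m≤o∸n =
  ℕ.m+n≤o⇒m≤o∸n n (subst (_≤ o) (ℕ.+-comm m n) (ℕ.m≤o∸n⇒m+n≤o m n≤o m≤o∸n))

rises-as-descents : ∀ {k t i j} → t ≤ k → i < k → j < k →
  (i <ᵇ j) ∧ (i <ᵇ k ∸ t) ≡ (t ≤ᵇ k ∸ suc i) ∧ (k ∸ suc j <ᵇ k ∸ suc i)
rises-as-descents {k} {t} {i} {j} t≤k i<k j<k = trans (cong₂ _∧_
  (det (ℕ.<ᵇ-reflects-< i j) (fromEquivalence
    (λ h → ℕ.≤-pred (ℕ.∸-cancelʳ-< {o = k} (ℕ.<ᵇ⇒< (k ∸ suc j) (k ∸ suc i) h)))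
    (λ i<j → ℕ.<⇒<ᵇ (ℕ.∸-monoʳ-< (s≤s i<j) j<k))))
  (det (ℕ.<ᵇ-reflects-< i (k ∸ t)) (fromEquivalence
    (λ h → ∸-swap i<k (ℕ.≤ᵇ⇒≤ t (k ∸ suc i) h))
    (λ i<r → ℕ.≤⇒≤ᵇ (∸-swap t≤k i<r)))))
  (∧-comm (k ∸ suc j <ᵇ k ∸ suc i) (t ≤ᵇ k ∸ suc i))

rise-spec : ∀ {k t} → t ≤ k → ∀ (a c : Fin k) →
  (val a <ᵇ val c) ∧ (val a ≤ᵇ k ∸ t)
  ≡ (t ≤ᵇ toℕ (Perm.reverse ⟨$⟩ʳ a)) ∧ (toℕ (Perm.reverse ⟨$⟩ʳ c) <ᵇ toℕ (Perm.reverse ⟨$⟩ʳ a))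
rise-spec {k} {t} t≤k a c = trans (rises-as-descents t≤k (toℕ<n a) (toℕ<n c))
  (sym (cong₂ (λ x y → (t ≤ᵇ x) ∧ (y <ᵇ x)) (opposite-prop a) (opposite-prop c)))

theorem4p2 : (k t n s : ℕ) → 1 ≤ t → t ≤ k →
    (+ count (λ w → desAbove t w ≡ᵇ s) (allWords k n) ≡ formula k t n s)
    × (+ count (λ w → risBelow (k ∸ t) w ≡ᵇ s) (allWords k n) ≡ formula k t n s)
theorem4p2 k t n s _ t≤k =
  WordSide.T≡formula k t t≤k (λ a b → (b <ᵇ a) ∧ (t <ᵇ a)) Perm.id (descent-spec t) n s ,
  WordSide.T≡formula k t t≤k (λ a b → (a <ᵇ b) ∧ (a ≤ᵇ k ∸ t)) Perm.reverse (rise-spec t≤k) n s
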